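{- For all non-negative integers $n,k,\ell,j$ with $0\le j\le \ell$, there exists a bijection from $\mathcal{W}(n,k,\ell,j)$ to $\mathcal{A}(n,k,\ell,j)$; in particular these two finite sets have the same cardinality.
   Context: Words are over the alphabet $\{x,y,z\}$. Let $\mathcal{W}$ be the set of words that are empty or end with $x$ or $z$. For $u=u_1\cdots u_m$ define the weight $\omega(u)=\sum_{i=1}^m \chi(u_i\ne y)\,(i+|\{j\le i: u_j=z\}|)$, where $\chi(S)$ is $1$ if $S$ holds and $0$ otherwise. In a word $u$, a letter $u_i=z$ is called odd (resp. even) if the number of indices $t<i$ such that $u_t$ is $y$ or is an odd $z$ is odd (resp. even) (this defines parity recursively from left to right). $\mathcal{W}(n,k,\ell,j)$ is the set of words in $\mathcal{W}$ of weight $n$ with exactly $k$ letters $x$, exactly $\ell$ letters $z$, exactly $j$ of which are odd. A two-color partition is a partition each of whose parts is colored red or green. $\mathcal{A}(n,k,\ell,j)$ is the set of two-color partitions of $n$ consisting of $k+j$ pairwise distinct red parts and $\ell$ pairwise distinct even green parts, such that exactly $k$ red parts are larger than $\ell$ (so exactly $j$ red parts are at most $\ell$). -}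

module Defs where

open import Data.Nat using (ℕ; zero; suc; _+_; _*_; _<_; _≤_)
open import Data.Bool using (Bool; true; false; not)
open import Data.List using (List; []; _∷_; length; filter)
open import Data.Nat.ListAction using (sum)
open import Data.List.Relation.Unary.All using (All)
open import Data.Product using (Σ; _×_)
open import Data.Nat.Properties using (_<?_)
open import Relation.Binary.PropositionalEquality using (_≡_)

data Letter : Set where
  x y z : Letter

Word : Set
Word = List Letter

data InW : Word → Set where
  empty : InW []
  endx  : ∀ {w} → InW (w Data.List.∷ʳ x)
  endz  : ∀ {w} → InW (w Data.List.∷ʳ z)

-- weight: ω(u) = Σ_i χ(u_i ≠ y) (i + #{j ≤ i : u_j = z}).
-- weightFrom i c u : weight contribution of u, whose first letter sits at
-- position i, with c letters z strictly before it.
weightFrom : ℕ → ℕ → Word → ℕ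
weightFrom i c []      = 0
weightFrom i c (x ∷ u) = (i + c) + weightFrom (suc i) c u
weightFrom i c (y ∷ u) = weightFrom (suc i) c u
weightFrom i c (z ∷ u) = (i + suc c) + weightFrom (suc i) (suc c) u

weight : Word → ℕ
weight = weightFrom 1 0

count : Letter → Word → ℕ
count l [] = 0
count x (x ∷ u) = suc (count x u)
count y (y ∷ u) = suc (count y u)
count z (z ∷ u) = suc (count z u)
count x (_ ∷ u) = count x u
count y (_ ∷ u) = count y u
count z (_ ∷ u) = count z u

-- oddFrom s u: number of odd z's in u, where s is the parity (true = odd)
-- of the number of earlier letters that are y or odd z.
-- A z is odd iff the current parity s is odd.
oddFrom : Bool → Word → ℕ
oddFrom s []      = 0
oddFrom s (x ∷ u) = oddFrom s u
oddFrom s (y ∷ u) = oddFrom (not s) u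
oddFrom true  (z ∷ u) = suc (oddFrom false u)
oddFrom false (z ∷ u) = oddFrom false u

oddZ : Word → ℕ
oddZ = oddFrom false

𝒲 : ℕ → ℕ → ℕ → ℕ → Set
𝒲 n k ℓ j = Σ Word (λ w → InW w × weight w ≡ n × count x w ≡ k
                              × count z w ≡ ℓ × oddZ w ≡ j)

-- strictly decreasing list of natural numbers (canonical form of a set
-- of pairwise distinct parts)
data StrictDec : List ℕ → Set where
  []  : StrictDec []
  [_] : ∀ a → StrictDec (a ∷ [])
  _∷_ : ∀ {a b l} → b < a → StrictDec (b ∷ l) → StrictDec (a ∷ b ∷ l)

data Even : ℕ → Set where
  even : ∀ m → Even (m + m)

countGreater : ℕ → List ℕ → ℕ
countGreater ℓ l = length (filter (ℓ <?_) l)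

-- A two-color partition with pairwise distinct red parts and pairwise
-- distinct green parts: a pair (red parts, green parts), each listed in
-- strictly decreasing order, all parts positive.
-- 𝒜(n,k,ℓ,j): k+j distinct red parts, ℓ distinct even green parts,
-- total n, exactly k red parts larger than ℓ.
𝒜 : ℕ → ℕ → ℕ → ℕ → Set
𝒜 n k ℓ j = Σ (List ℕ × List ℕ) λ p →
  let red = Data.Product.proj₁ p ; green = Data.Product.proj₂ p in
    StrictDec red × All (1 ≤_) red × length red ≡ k + j
  × StrictDec green × All (1 ≤_) green × All Even green × length green ≡ ℓ
  × sum red + sum green ≡ n
  × countGreater ℓ red ≡ k

-- Both sets are put in bijection with codes (E , M), pairs of lists of
-- naturals with |E| = k and |M| = ℓ. A word is coded by its runs of y's and
-- z's before each x and of y's before each z. Prepending a letter changes the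
-- weight of a word and the codeWeight of its code in the same way, and a z is
-- odd exactly when the run of y's before it is odd, so the statistics of a
-- word can be read off its code. A code in turn becomes a partition: E gives
-- the gaps between the red parts above ℓ, the halves ⌊ m /2⌋ of the entries of
-- M give the gaps between the halved green parts, and the positions of the odd
-- entries of M are the red parts up to ℓ; codeWeight is then the total size.
module Submission where

open import Defs
open import Axiom.UniquenessOfIdentityProofs.WithK using (uip)
open import Data.Bool using (Bool; true; false)
open import Data.Empty using (⊥-elim)
open import Data.List
  using (List; []; _∷_; _∷ʳ_; _++_; _ʳ++_; foldr; length; map; filter; reverse; takeWhile; dropWhile)
import Data.List.Properties as List
open import Data.List.Relation.Unary.All as All using (All; []; _∷_)
open import Data.List.Relation.Unary.All.Properties using (all-takeWhile; takeWhile⁺; dropWhile⁺)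
open import Data.Nat using (ℕ; zero; suc; _+_; _*_; _∸_; _≤_; _<_; z≤n; s≤s; ⌊_/2⌋)
open import Data.Nat.ListAction using (sum)
open import Data.Nat.Properties
open import Data.Nat.Tactic.RingSolver using (solve-∀)
open import Data.Product using (Σ; _×_; _,_; proj₁; proj₂)
open import Function.Base using (id; _∘_)
open import Function.Bundles using (_↔_; _⤖_; mk↔ₛ′)
open import Function.Construct.Composition using (_↔-∘_)
open import Function.Properties.Inverse using (↔⇒⤖)
open import Relation.Binary.PropositionalEquality
open import Relation.Nullary using (Irrelevant; yes; no; does)
open import Relation.Nullary.Decidable using (dec-true; dec-false)
open import Relation.Unary using (Decidable; ∁)

×-irrelevant : ∀ {A B : Set} → Irrelevant A → Irrelevant B → Irrelevant (A × B)
×-irrelevant A-irr B-irr (a , b) (a′ , b′) = cong₂ _,_ (A-irr a a′) (B-irr b b′)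

Σ-≡ : ∀ {A : Set} {P : A → Set} → (∀ {a} → Irrelevant (P a)) →
      ∀ {a b} {p : P a} {q : P b} → a ≡ b → _≡_ {A = Σ A P} (a , p) (b , q)
Σ-≡ P-irr {p = p} {q} refl = cong (_ ,_) (P-irr p q)

restrict-↔ : ∀ {A B : Set} {P : A → Set} {Q : B → Set} →
             (∀ {a} → Irrelevant (P a)) → (∀ {b} → Irrelevant (Q b)) →
             (f : A → B) (g : B → A) →
             (∀ {a} → P a → Q (f a)) → (∀ {b} → Q b → P (g b)) →
             (∀ {a} → P a → g (f a) ≡ a) → (∀ {b} → Q b → f (g b) ≡ b) →
             Σ A P ↔ Σ B Q
restrict-↔ P-irr Q-irr f g f-resp g-resp g∘f f∘g = mk↔ₛ′
  (λ (a , p) → f a , f-resp p) (λ (b , q) → g b , g-resp q)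
  (λ (b , q) → Σ-≡ Q-irr (f∘g q)) (λ (a , p) → Σ-≡ P-irr (g∘f p))

-- Words and their codes

[]≢∷ʳ : ∀ w {c : Letter} → [] ≢ w ∷ʳ c
[]≢∷ʳ []      ()
[]≢∷ʳ (_ ∷ _) ()

InW-irrelevant : ∀ {w} → Irrelevant (InW w)
InW-irrelevant p q = go p q refl
  where
  go : ∀ {u v} (p : InW u) (q : InW v) (e : u ≡ v) → subst InW e p ≡ q
  go empty      empty      refl = refl
  go empty      (endx {b}) e    = ⊥-elim ([]≢∷ʳ b e)
  go empty      (endz {b}) e    = ⊥-elim ([]≢∷ʳ b e)
  go (endx {a}) empty      e    = ⊥-elim ([]≢∷ʳ a (sym e))
  go (endz {a}) empty      e    = ⊥-elim ([]≢∷ʳ a (sym e))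
  go (endx {a}) (endz {b}) e    with () ← List.∷ʳ-injectiveʳ a b e
  go (endz {a}) (endx {b}) e    with () ← List.∷ʳ-injectiveʳ a b e
  go (endx {a}) (endx {b}) e    with refl ← List.∷ʳ-injectiveˡ a b e with refl ← uip e refl = refl
  go (endz {a}) (endz {b}) e    with refl ← List.∷ʳ-injectiveˡ a b e with refl ← uip e refl = refl

-- Inductive form of InW: every y is followed by another letter.
data Admissible : Word → Set where
  []  : Admissible []
  x∷  : ∀ {w} → Admissible w → Admissible (x ∷ w)
  z∷  : ∀ {w} → Admissible w → Admissible (z ∷ w)
  y∷  : ∀ {w} → w ≢ [] → Admissible w → Admissible (y ∷ w)

∷ʳ-admissible : ∀ {c} → Admissible (c ∷ []) → ∀ w → Admissible (w ∷ʳ c)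
∷ʳ-admissible last []      = last
∷ʳ-admissible last (x ∷ w) = x∷ (∷ʳ-admissible last w)
∷ʳ-admissible last (y ∷ w) = y∷ (λ e → []≢∷ʳ w (sym e)) (∷ʳ-admissible last w)
∷ʳ-admissible last (z ∷ w) = z∷ (∷ʳ-admissible last w)

InW⇒admissible : ∀ {w} → InW w → Admissible w
InW⇒admissible empty      = []
InW⇒admissible (endx {w}) = ∷ʳ-admissible (x∷ []) w
InW⇒admissible (endz {w}) = ∷ʳ-admissible (z∷ []) w

InW-∷ : ∀ {a w} → InW w → w ≢ [] → InW (a ∷ w)
InW-∷     empty      w≢[] = ⊥-elim (w≢[] refl)
InW-∷ {a} (endx {w}) _    = endx {a ∷ w}
InW-∷ {a} (endz {w}) _    = endz {a ∷ w}

admissible⇒InW : ∀ {w} → Admissible w → InW w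
admissible⇒InW []             = empty
admissible⇒InW (x∷ {[]} _)    = endx {[]}
admissible⇒InW (x∷ {_ ∷ _} α) = InW-∷ (admissible⇒InW α) λ ()
admissible⇒InW (z∷ {[]} _)    = endz {[]}
admissible⇒InW (z∷ {_ ∷ _} α) = InW-∷ (admissible⇒InW α) λ ()
admissible⇒InW (y∷ w≢[] α)    = InW-∷ (admissible⇒InW α) w≢[]

Code : Set
Code = List ℕ × List ℕ

bumpHead : List ℕ → List ℕ
bumpHead []      = []
bumpHead (a ∷ l) = suc a ∷ l

-- The code (E , M) of a word lists, for each x, the number of y's and z's
-- since the previous x (in E), and for each z, the number of y's since the
-- previous z (in M).
step : Letter → Code → Code
step x (E , M) = 0 ∷ E , M
step y (E , M) = bumpHead E , bumpHead M
step z (E , M) = bumpHead E , 0 ∷ M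

encode : Word → Code
encode = foldr step ([] , [])

-- decodeZ m M = decode′ [] (m ∷ M) and decodeX e E M = decode′ (e ∷ E) M;
-- splitting off the head makes the recursion structural.
mutual
  decode′ : List ℕ → List ℕ → Word
  decode′ []      []      = []
  decode′ []      (m ∷ M) = decodeZ m M
  decode′ (e ∷ E) M       = decodeX e E M

  decodeZ : ℕ → List ℕ → Word
  decodeZ zero    M = z ∷ decode′ [] M
  decodeZ (suc m) M = y ∷ decodeZ m M

  decodeX : ℕ → List ℕ → List ℕ → Word
  decodeX zero    E M           = x ∷ decode′ E M
  decodeX (suc e) E []          = y ∷ decodeX e E []
  decodeX (suc e) E (zero ∷ M)  = z ∷ decodeX e E M
  decodeX (suc e) E (suc m ∷ M) = y ∷ decodeX e E (m ∷ M)

decode : Code → Word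
decode (E , M) = decode′ E M

mutual
  encode-decode′ : ∀ E M → encode (decode′ E M) ≡ (E , M)
  encode-decode′ []      []      = refl
  encode-decode′ []      (m ∷ M) = encode-decodeZ m M
  encode-decode′ (e ∷ E) M       = encode-decodeX e E M

  encode-decodeZ : ∀ m M → encode (decodeZ m M) ≡ ([] , m ∷ M)
  encode-decodeZ zero    M = cong (step z) (encode-decode′ [] M)
  encode-decodeZ (suc m) M = cong (step y) (encode-decodeZ m M)

  encode-decodeX : ∀ e E M → encode (decodeX e E M) ≡ (e ∷ E , M)
  encode-decodeX zero    E M           = cong (step x) (encode-decode′ E M)
  encode-decodeX (suc e) E []          = cong (step y) (encode-decodeX e E [])
  encode-decodeX (suc e) E (zero ∷ M)  = cong (step z) (encode-decodeX e E M)
  encode-decodeX (suc e) E (suc m ∷ M) = cong (step y) (encode-decodeX e E (m ∷ M))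

encode-decode : ∀ c → encode (decode c) ≡ c
encode-decode (E , M) = encode-decode′ E M

decodeZ≢[] : ∀ m M → decodeZ m M ≢ []
decodeZ≢[] zero    M = λ ()
decodeZ≢[] (suc m) M = λ ()

decodeX≢[] : ∀ e E M → decodeX e E M ≢ []
decodeX≢[] zero    E M           = λ ()
decodeX≢[] (suc e) E []          = λ ()
decodeX≢[] (suc e) E (zero ∷ M)  = λ ()
decodeX≢[] (suc e) E (suc m ∷ M) = λ ()

mutual
  decode′-admissible : ∀ E M → Admissible (decode′ E M)
  decode′-admissible []      []      = []
  decode′-admissible []      (m ∷ M) = decodeZ-admissible m M
  decode′-admissible (e ∷ E) M       = decodeX-admissible e E M

  decodeZ-admissible : ∀ m M → Admissible (decodeZ m M)
  decodeZ-admissible zero    M = z∷ (decode′-admissible [] M)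
  decodeZ-admissible (suc m) M = y∷ (decodeZ≢[] m M) (decodeZ-admissible m M)

  decodeX-admissible : ∀ e E M → Admissible (decodeX e E M)
  decodeX-admissible zero    E M           = x∷ (decode′-admissible E M)
  decodeX-admissible (suc e) E []          = y∷ (decodeX≢[] e E []) (decodeX-admissible e E [])
  decodeX-admissible (suc e) E (zero ∷ M)  = z∷ (decodeX-admissible e E M)
  decodeX-admissible (suc e) E (suc m ∷ M) =
    y∷ (decodeX≢[] e E (m ∷ M)) (decodeX-admissible e E (m ∷ M))

decode-admissible : ∀ c → Admissible (decode c)
decode-admissible (E , M) = decode′-admissible E M

decode-step-y : ∀ c → decode c ≢ [] → decode (step y c) ≡ y ∷ decode c
decode-step-y ([]    , [])    c≢[] = ⊥-elim (c≢[] refl)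
decode-step-y ([]    , _ ∷ _) _    = refl
decode-step-y (_ ∷ _ , [])    _    = refl
decode-step-y (_ ∷ _ , _ ∷ _) _    = refl

decode-step-z : ∀ c → decode (step z c) ≡ z ∷ decode c
decode-step-z ([]    , _) = refl
decode-step-z (_ ∷ _ , _) = refl

decode-encode : ∀ {w} → Admissible w → decode (encode w) ≡ w
decode-encode []           = refl
decode-encode (x∷ α)       = cong (x ∷_) (decode-encode α)
decode-encode (z∷ {w} α)   = trans (decode-step-z (encode w)) (cong (z ∷_) (decode-encode α))
decode-encode (y∷ {w} w≢[] α) =
  trans (decode-step-y (encode w) (w≢[] ∘ trans (sym ih))) (cong (y ∷_) ih)
  where
  ih = decode-encode α

-- Statistics of a word read off its code

length-bumpHead : ∀ l → length (bumpHead l) ≡ length l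
length-bumpHead []      = refl
length-bumpHead (_ ∷ _) = refl

count-x≡length : ∀ w → count x w ≡ length (proj₁ (encode w))
count-x≡length []      = refl
count-x≡length (x ∷ w) = cong suc (count-x≡length w)
count-x≡length (y ∷ w) = trans (count-x≡length w) (sym (length-bumpHead (proj₁ (encode w))))
count-x≡length (z ∷ w) = trans (count-x≡length w) (sym (length-bumpHead (proj₁ (encode w))))

count-z≡length : ∀ w → count z w ≡ length (proj₂ (encode w))
count-z≡length []      = refl
count-z≡length (x ∷ w) = count-z≡length w
count-z≡length (y ∷ w) = trans (count-z≡length w) (sym (length-bumpHead (proj₂ (encode w))))
count-z≡length (z ∷ w) = cong suc (count-z≡length w)

nonY : Word → ℕ
nonY w = count x w + count z w

size : Code → ℕ
size (E , M) = length E + length M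

nonY≡size : ∀ w → nonY w ≡ size (encode w)
nonY≡size w = cong₂ _+_ (count-x≡length w) (count-z≡length w)

weightFrom-shift : ∀ i a c b w → weightFrom (i + a) (c + b) w ≡ weightFrom i c w + (a + b) * nonY w
weightFrom-shift i a c b []      = sym (*-zeroʳ (a + b))
weightFrom-shift i a c b (x ∷ w) =
  trans (cong (i + a + (c + b) +_) (weightFrom-shift (suc i) a c b w))
        (regroup i a c b _ (count x w) (count z w))
  where
  regroup : ∀ i a c b W X Z →
            i + a + (c + b) + (W + (a + b) * (X + Z)) ≡ i + c + W + (a + b) * (suc X + Z)
  regroup = solve-∀
weightFrom-shift i a c b (y ∷ w) = weightFrom-shift (suc i) a c b w
weightFrom-shift i a c b (z ∷ w) =
  trans (cong (i + a + suc (c + b) +_) (weightFrom-shift (suc i) a (suc c) b w))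
        (regroup i a c b _ (count x w) (count z w))
  where
  regroup : ∀ i a c b W X Z →
            i + a + suc (c + b) + (W + (a + b) * (X + Z)) ≡ i + suc c + W + (a + b) * (X + suc Z)
  regroup = solve-∀

-- Prepending a moves every other letter one place to the right and, when
-- a = z, also raises the number of z's up to it by one.
shift : Letter → ℕ
shift z = 2
shift _ = 1

weight-∷ : ∀ a w → weight (a ∷ w) ≡ weight (a ∷ []) + weight w + shift a * nonY w
weight-∷ x w = cong suc (weightFrom-shift 1 1 0 0 w)
weight-∷ y w = weightFrom-shift 1 1 0 0 w
weight-∷ z w = cong (2 +_) (weightFrom-shift 1 1 0 1 w)

triangle : ℕ → ℕ
triangle zero    = zero
triangle (suc k) = suc k + triangle k

weightedSum : List ℕ → ℕ
weightedSum []      = 0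
weightedSum (a ∷ l) = a * suc (length l) + weightedSum l

codeWeight : Code → ℕ
codeWeight (E , M) =
  triangle (length E) + length E * length M + (triangle (length M) + triangle (length M))
  + weightedSum E + weightedSum M

weightedSum-bumpHead : ∀ l → weightedSum (bumpHead l) ≡ weightedSum l + length l
weightedSum-bumpHead []      = refl
weightedSum-bumpHead (a ∷ l) = regroup a (length l) (weightedSum l)
  where
  regroup : ∀ a n s → suc a * suc n + s ≡ a * suc n + s + suc n
  regroup = solve-∀

codeWeight-step : ∀ a c → codeWeight (step a c) ≡ weight (a ∷ []) + codeWeight c + shift a * size c
codeWeight-step x (E , M) =
  regroup (length E) (length M) (triangle (length E)) (triangle (length M)) (weightedSum E) (weightedSum M)
  where
  regroup : ∀ k ℓ tk tℓ wE wM →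
            suc k + tk + suc k * ℓ + (tℓ + tℓ) + (0 * suc k + wE) + wM
            ≡ 1 + (tk + k * ℓ + (tℓ + tℓ) + wE + wM) + 1 * (k + ℓ)
  regroup = solve-∀
codeWeight-step y (E , M)
  rewrite length-bumpHead E | length-bumpHead M | weightedSum-bumpHead E | weightedSum-bumpHead M =
  regroup (length E) (length M) (triangle (length E)) (triangle (length M)) (weightedSum E) (weightedSum M)
  where
  regroup : ∀ k ℓ tk tℓ wE wM →
            tk + k * ℓ + (tℓ + tℓ) + (wE + k) + (wM + ℓ)
            ≡ 0 + (tk + k * ℓ + (tℓ + tℓ) + wE + wM) + 1 * (k + ℓ)
  regroup = solve-∀
codeWeight-step z (E , M)
  rewrite length-bumpHead E | weightedSum-bumpHead E =
  regroup (length E) (length M) (triangle (length E)) (triangle (length M)) (weightedSum E) (weightedSum M)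
  where
  regroup : ∀ k ℓ tk tℓ wE wM →
            tk + k * suc ℓ + ((suc ℓ + tℓ) + (suc ℓ + tℓ)) + (wE + k) + (0 * suc ℓ + wM)
            ≡ 2 + (tk + k * ℓ + (tℓ + tℓ) + wE + wM) + 2 * (k + ℓ)
  regroup = solve-∀

weight≡codeWeight : ∀ w → weight w ≡ codeWeight (encode w)
weight≡codeWeight []      = refl
weight≡codeWeight (a ∷ w) = begin
  weight (a ∷ w)                                                  ≡⟨ weight-∷ a w ⟩
  weight (a ∷ []) + weight w + shift a * nonY w                   ≡⟨ cong₂ (λ u v → weight (a ∷ []) + u + shift a * v)
                                                                       (weight≡codeWeight w) (nonY≡size w) ⟩
  weight (a ∷ []) + codeWeight (encode w) + shift a * size (encode w) ≡⟨ codeWeight-step a (encode w) ⟨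
  codeWeight (encode (a ∷ w))                                     ∎
  where open ≡-Reasoning

mod2 : ℕ → ℕ
mod2 zero          = 0
mod2 (suc zero)    = 1
mod2 (suc (suc n)) = mod2 n

oddCount : List ℕ → ℕ
oddCount = sum ∘ map mod2

bumpIf : Bool → List ℕ → List ℕ
bumpIf false = id
bumpIf true  = bumpHead

oddCount-bumpHead² : ∀ l → oddCount (bumpHead (bumpHead l)) ≡ oddCount l
oddCount-bumpHead² []      = refl
oddCount-bumpHead² (_ ∷ _) = refl

-- The parity s in oddFrom is that of the current run of y's, since every z
-- resets it to even: a z is odd exactly when the run of y's before it is odd.
oddFrom≡oddCount : ∀ s w → oddFrom s w ≡ oddCount (bumpIf s (proj₂ (encode w)))
oddFrom≡oddCount false []      = refl
oddFrom≡oddCount true  []      = refl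
oddFrom≡oddCount s     (x ∷ w) = oddFrom≡oddCount s w
oddFrom≡oddCount false (y ∷ w) = oddFrom≡oddCount true w
oddFrom≡oddCount true  (y ∷ w) =
  trans (oddFrom≡oddCount false w) (sym (oddCount-bumpHead² (proj₂ (encode w))))
oddFrom≡oddCount false (z ∷ w) = oddFrom≡oddCount false w
oddFrom≡oddCount true  (z ∷ w) = cong suc (oddFrom≡oddCount false w)

IsWord : ℕ → ℕ → ℕ → ℕ → Word → Set
IsWord n k ℓ j w = InW w × weight w ≡ n × count x w ≡ k × count z w ≡ ℓ × oddZ w ≡ j

IsCode : ℕ → ℕ → ℕ → ℕ → Code → Set
IsCode n k ℓ j (E , M) = length E ≡ k × length M ≡ ℓ × codeWeight (E , M) ≡ n × oddCount M ≡ j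

IsWord-irrelevant : ∀ {n k ℓ j w} → Irrelevant (IsWord n k ℓ j w)
IsWord-irrelevant = ×-irrelevant InW-irrelevant (×-irrelevant uip (×-irrelevant uip (×-irrelevant uip uip)))

IsCode-irrelevant : ∀ {n k ℓ j c} → Irrelevant (IsCode n k ℓ j c)
IsCode-irrelevant = ×-irrelevant uip (×-irrelevant uip (×-irrelevant uip uip))

decode-preserves : ∀ {S : Word → ℕ} (S′ : Code → ℕ) → (∀ w → S w ≡ S′ (encode w)) →
                   ∀ c {v} → S′ c ≡ v → S (decode c) ≡ v
decode-preserves S′ S≡S′ c eq = trans (S≡S′ (decode c)) (trans (cong S′ (encode-decode c)) eq)

words↔codes : ∀ n k ℓ j → Σ Word (IsWord n k ℓ j) ↔ Σ Code (IsCode n k ℓ j)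
words↔codes n k ℓ j =
  restrict-↔ (λ {w} → IsWord-irrelevant {w = w}) (λ {c} → IsCode-irrelevant {c = c}) encode decode (λ {w} → to-code {w}) (λ {c} → from-code {c})
             (decode-encode ∘ InW⇒admissible ∘ proj₁) (λ {c} _ → encode-decode c)
  where
  to-code : ∀ {w} → IsWord n k ℓ j w → IsCode n k ℓ j (encode w)
  to-code {w} (_ , wn , xk , zℓ , oj) =
    trans (sym (count-x≡length w)) xk , trans (sym (count-z≡length w)) zℓ ,
    trans (sym (weight≡codeWeight w)) wn , trans (sym (oddFrom≡oddCount false w)) oj
  from-code : ∀ {c} → IsCode n k ℓ j c → IsWord n k ℓ j (decode c)
  from-code {c} (Ek , Mℓ , cn , oj) =
    admissible⇒InW (decode-admissible c) ,
    decode-preserves codeWeight weight≡codeWeight c cn ,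
    decode-preserves (length ∘ proj₁) count-x≡length c Ek ,
    decode-preserves (length ∘ proj₂) count-z≡length c Mℓ ,
    decode-preserves (oddCount ∘ proj₂) (oddFrom≡oddCount false) c oj

All-ʳ++ : ∀ {P : ℕ → Set} {xs ys} → All P xs → All P ys → All P (xs ʳ++ ys)
All-ʳ++ []         pbs = pbs
All-ʳ++ (pa ∷ pas) pbs = All-ʳ++ pas (pa ∷ pbs)

sum-ʳ++ : ∀ xs ys → sum (xs ʳ++ ys) ≡ sum xs + sum ys
sum-ʳ++ []       ys = refl
sum-ʳ++ (a ∷ xs) ys = trans (sum-ʳ++ xs (a ∷ ys)) (regroup (sum xs) a (sum ys))
  where
  regroup : ∀ s a t → s + (a + t) ≡ (a + s) + t
  regroup = solve-∀

climb : ℕ → List ℕ → List ℕ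
climb b []      = []
climb b (e ∷ E) = suc (b + e) ∷ climb (suc (b + e)) E

gaps : ℕ → List ℕ → List ℕ
gaps b []      = []
gaps b (a ∷ l) = a ∸ suc b ∷ gaps a l

data Ascending : ℕ → List ℕ → Set where
  []  : ∀ {b} → Ascending b []
  _∷_ : ∀ {b a l} → b < a → Ascending a l → Ascending b (a ∷ l)

climb-ascending : ∀ b E → Ascending b (climb b E)
climb-ascending b []      = []
climb-ascending b (e ∷ E) = s≤s (m≤m+n b e) ∷ climb-ascending _ E

gaps-climb : ∀ b E → gaps b (climb b E) ≡ E
gaps-climb b []      = refl
gaps-climb b (e ∷ E) = cong₂ _∷_ (m+n∸m≡n b e) (gaps-climb _ E)

climb-gaps : ∀ {b l} → Ascending b l → climb b (gaps b l) ≡ l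
climb-gaps []                    = refl
climb-gaps (_∷_ {a = a} b<a a<l) rewrite m+[n∸m]≡n b<a = cong (a ∷_) (climb-gaps a<l)

length-climb : ∀ b E → length (climb b E) ≡ length E
length-climb b []      = refl
length-climb b (e ∷ E) = cong suc (length-climb _ E)

length-gaps : ∀ b l → length (gaps b l) ≡ length l
length-gaps b []      = refl
length-gaps b (a ∷ l) = cong suc (length-gaps a l)

sum-climb : ∀ b E → sum (climb b E) ≡ length E * b + triangle (length E) + weightedSum E
sum-climb b []      = refl
sum-climb b (e ∷ E) =
  trans (cong (suc (b + e) +_) (sum-climb (suc (b + e)) E))
        (regroup b e (length E) (triangle (length E)) (weightedSum E))
  where
  regroup : ∀ b e k t w → suc (b + e) + (k * suc (b + e) + t + w) ≡ suc k * b + (suc k + t) + (e * suc k + w)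
  regroup = solve-∀

ascending⇒all : ∀ {b l} → Ascending b l → All (b <_) l
ascending⇒all []          = []
ascending⇒all (b<a ∷ a<l) = b<a ∷ All.map (<-trans b<a) (ascending⇒all a<l)

strictDec⇒all : ∀ {a l} → StrictDec (a ∷ l) → All (_< a) l
strictDec⇒all [ _ ]       = []
strictDec⇒all (b<a ∷ b>l) = b<a ∷ All.map (λ c<b → <-trans c<b b<a) (strictDec⇒all b>l)

strictDec-tail : ∀ {a l} → StrictDec (a ∷ l) → StrictDec l
strictDec-tail [ _ ]   = []
strictDec-tail (_ ∷ d) = d

∷-strictDec : ∀ {a l} → All (_< a) l → StrictDec l → StrictDec (a ∷ l)
∷-strictDec []        []  = [ _ ]
∷-strictDec (b<a ∷ _) d   = b<a ∷ d

ʳ++-strictDec : ∀ {b xs ys} → Ascending b xs → StrictDec ys → All (_≤ b) ys → StrictDec (xs ʳ++ ys)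
ʳ++-strictDec []          d ys≤b = d
ʳ++-strictDec (b<a ∷ a<l) d ys≤b =
  ʳ++-strictDec a<l (∷-strictDec (All.map (λ c≤b → ≤-<-trans c≤b b<a) ys≤b) d)
                    (≤-refl ∷ All.map (λ c≤b → ≤-trans c≤b (<⇒≤ b<a)) ys≤b)

reverse-ascending : ∀ {b xs} → StrictDec xs → All (b <_) xs → Ascending b (reverse xs)
reverse-ascending []  []            = []
reverse-ascending d   b<xs@(_ ∷ _) = go d b<xs []
  where
  go : ∀ {b a xs acc} → StrictDec (a ∷ xs) → All (b <_) (a ∷ xs) → Ascending a acc →
       Ascending b ((a ∷ xs) ʳ++ acc)
  go {xs = []}    _          (b<a ∷ _)  a<acc = b<a ∷ a<acc
  go {xs = _ ∷ _} (a′<a ∷ d) (_ ∷ b<xs) a<acc = go d b<xs (a′<a ∷ a<acc)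

module _ {P : ℕ → Set} (P? : Decidable P) where

  takeWhile-++ : ∀ {xs ys} → All P xs → All (∁ P) ys → takeWhile P? (xs ++ ys) ≡ xs
  takeWhile-++ {ys = []}    []         _          = refl
  takeWhile-++ {ys = b ∷ _} []         (¬pb ∷ _)  rewrite dec-false (P? b) ¬pb = refl
  takeWhile-++ {a ∷ _}      (pa ∷ pas) ¬pbs       rewrite dec-true (P? a) pa =
    cong (a ∷_) (takeWhile-++ pas ¬pbs)

  dropWhile-++ : ∀ {xs ys} → All P xs → All (∁ P) ys → dropWhile P? (xs ++ ys) ≡ ys
  dropWhile-++ {ys = []}    []         _          = refl
  dropWhile-++ {ys = b ∷ _} []         (¬pb ∷ _)  rewrite dec-false (P? b) ¬pb = refl
  dropWhile-++ {a ∷ _}      (pa ∷ pas) ¬pbs       rewrite dec-true (P? a) pa =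
    dropWhile-++ pas ¬pbs

  length-filter-++ : ∀ {xs ys} → All P xs → All (∁ P) ys → length (filter P? (xs ++ ys)) ≡ length xs
  length-filter-++ []         ¬pbs = cong length (List.filter-none P? ¬pbs)
  length-filter-++ (pa ∷ pas) ¬pbs =
    trans (cong length (List.filter-accept P? pa)) (cong suc (length-filter-++ pas ¬pbs))

  takeWhile-strictDec : ∀ {l} → StrictDec l → StrictDec (takeWhile P? l)
  takeWhile-strictDec {[]}    d = d
  takeWhile-strictDec {a ∷ l} d with does (P? a)
  ... | true  = ∷-strictDec (takeWhile⁺ P? (strictDec⇒all d)) (takeWhile-strictDec (strictDec-tail d))
  ... | false = []

  dropWhile-strictDec : ∀ {l} → StrictDec l → StrictDec (dropWhile P? l)
  dropWhile-strictDec {[]}    d = d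
  dropWhile-strictDec {a ∷ l} d with does (P? a)
  ... | true  = dropWhile-strictDec (strictDec-tail d)
  ... | false = d

dropWhile-≤ : ∀ {ℓ} (ℓ<? : Decidable (ℓ <_)) {l} → StrictDec l → All (_≤ ℓ) (dropWhile ℓ<? l)
dropWhile-≤ ℓ<? {[]}    d = []
dropWhile-≤ ℓ<? {a ∷ l} d with ℓ<? a
... | yes _   = dropWhile-≤ ℓ<? (strictDec-tail d)
... | no  ℓ≮a = ≮⇒≥ ℓ≮a ∷ All.map (λ b<a → ≤-trans (<⇒≤ b<a) (≮⇒≥ ℓ≮a)) (strictDec⇒all d)

-- Splitting a list of naturals into halves and odd positions

twicePlus : ℕ → ℕ → ℕ
twicePlus zero    b = b
twicePlus (suc h) b = suc (suc (twicePlus h b))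

twicePlus-half-mod2 : ∀ m → twicePlus ⌊ m /2⌋ (mod2 m) ≡ m
twicePlus-half-mod2 zero          = refl
twicePlus-half-mod2 (suc zero)    = refl
twicePlus-half-mod2 (suc (suc m)) = cong (suc ∘ suc) (twicePlus-half-mod2 m)

half-twicePlus : ∀ h {b} → b ≤ 1 → ⌊ twicePlus h b /2⌋ ≡ h
half-twicePlus zero    z≤n       = refl
half-twicePlus zero    (s≤s z≤n) = refl
half-twicePlus (suc h) b≤1       = cong suc (half-twicePlus h b≤1)

half+half+mod2 : ∀ m → ⌊ m /2⌋ + ⌊ m /2⌋ + mod2 m ≡ m
half+half+mod2 zero          = refl
half+half+mod2 (suc zero)    = refl
half+half+mod2 (suc (suc m)) = trans (regroup ⌊ m /2⌋ (mod2 m)) (cong (suc ∘ suc) (half+half+mod2 m))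
  where
  regroup : ∀ h b → suc h + suc h + b ≡ suc (suc (h + h + b))
  regroup = solve-∀

consIfOdd : ℕ → ℕ → List ℕ → List ℕ
consIfOdd zero          v l = l
consIfOdd (suc zero)    v l = v ∷ l
consIfOdd (suc (suc m)) v l = consIfOdd m v l

consIfOdd-twicePlus : ∀ h b v l → consIfOdd (twicePlus h b) v l ≡ consIfOdd b v l
consIfOdd-twicePlus zero    b v l = refl
consIfOdd-twicePlus (suc h) b v l = consIfOdd-twicePlus h b v l

consIfOdd-All : ∀ {P : ℕ → Set} m {v l} → P v → All P l → All P (consIfOdd m v l)
consIfOdd-All zero          pv pl = pl
consIfOdd-All (suc zero)    pv pl = pv ∷ pl
consIfOdd-All (suc (suc m)) pv pl = consIfOdd-All m pv pl

consIfOdd-strictDec : ∀ m {v l} → All (_< v) l → StrictDec l → StrictDec (consIfOdd m v l)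
consIfOdd-strictDec zero          l<v d = d
consIfOdd-strictDec (suc zero)    l<v d = ∷-strictDec l<v d
consIfOdd-strictDec (suc (suc m)) l<v d = consIfOdd-strictDec m l<v d

length-consIfOdd : ∀ m v l → length (consIfOdd m v l) ≡ mod2 m + length l
length-consIfOdd zero          v l = refl
length-consIfOdd (suc zero)    v l = refl
length-consIfOdd (suc (suc m)) v l = length-consIfOdd m v l

sum-consIfOdd : ∀ m v l → sum (consIfOdd m v l) ≡ mod2 m * v + sum l
sum-consIfOdd zero          v l = refl
sum-consIfOdd (suc zero)    v l = cong (_+ sum l) (sym (+-identityʳ v))
sum-consIfOdd (suc (suc m)) v l = sum-consIfOdd m v l

-- Positions are counted from the right end of the list, starting at 1.
oddPositions : List ℕ → List ℕ
oddPositions []      = []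
oddPositions (m ∷ M) = consIfOdd m (suc (length M)) (oddPositions M)

oddPositions-≤ : ∀ M → All (_≤ length M) (oddPositions M)
oddPositions-≤ []      = []
oddPositions-≤ (m ∷ M) = consIfOdd-All m ≤-refl (All.map m≤n⇒m≤1+n (oddPositions-≤ M))

oddPositions-positive : ∀ M → All (1 ≤_) (oddPositions M)
oddPositions-positive []      = []
oddPositions-positive (m ∷ M) = consIfOdd-All m (s≤s z≤n) (oddPositions-positive M)

oddPositions-strictDec : ∀ M → StrictDec (oddPositions M)
oddPositions-strictDec []      = []
oddPositions-strictDec (m ∷ M) =
  consIfOdd-strictDec m (All.map s≤s (oddPositions-≤ M)) (oddPositions-strictDec M)

length-oddPositions : ∀ M → length (oddPositions M) ≡ oddCount M
length-oddPositions []      = refl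
length-oddPositions (m ∷ M) =
  trans (length-consIfOdd m _ (oddPositions M)) (cong (mod2 m +_) (length-oddPositions M))

halves : List ℕ → List ℕ
halves = map ⌊_/2⌋

weightedSum-halves : ∀ M → weightedSum M ≡ weightedSum (halves M) + weightedSum (halves M) + sum (oddPositions M)
weightedSum-halves []      = refl
weightedSum-halves (m ∷ M) = begin
  m * suc ℓ + weightedSum M
    ≡⟨ cong₂ (λ a b → a * suc ℓ + b) (sym (half+half+mod2 m)) (weightedSum-halves M) ⟩
  (h + h + mod2 m) * suc ℓ + (H + H + sum (oddPositions M))
    ≡⟨ regroup h (mod2 m) ℓ H (sum (oddPositions M)) ⟩
  (h * suc ℓ + H) + (h * suc ℓ + H) + (mod2 m * suc ℓ + sum (oddPositions M))
    ≡⟨ cong₂ (λ a b → a + a + b) (cong (λ n → h * suc n + H) (sym (List.length-map ⌊_/2⌋ M)))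
                                   (sym (sum-consIfOdd m (suc ℓ) (oddPositions M))) ⟩
  weightedSum (halves (m ∷ M)) + weightedSum (halves (m ∷ M)) + sum (oddPositions (m ∷ M)) ∎
  where
  open ≡-Reasoning
  ℓ = length M
  h = ⌊ m /2⌋
  H = weightedSum (halves M)
  regroup : ∀ h b ℓ H O → (h + h + b) * suc ℓ + (H + H + O) ≡ (h * suc ℓ + H) + (h * suc ℓ + H) + (b * suc ℓ + O)
  regroup = solve-∀

unsplit : List ℕ → List ℕ → List ℕ
unsplit []       S       = []
unsplit (h ∷ hs) []      = twicePlus h 0 ∷ unsplit hs []
unsplit (h ∷ hs) (a ∷ S) with a ≟ suc (length hs)
... | yes _ = twicePlus h 1 ∷ unsplit hs S
... | no  _ = twicePlus h 0 ∷ unsplit hs (a ∷ S)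

length-unsplit : ∀ hs S → length (unsplit hs S) ≡ length hs
length-unsplit []       S       = refl
length-unsplit (h ∷ hs) []      = cong suc (length-unsplit hs [])
length-unsplit (h ∷ hs) (a ∷ S) with a ≟ suc (length hs)
... | yes _ = cong suc (length-unsplit hs S)
... | no  _ = cong suc (length-unsplit hs (a ∷ S))

halves-unsplit : ∀ hs S → halves (unsplit hs S) ≡ hs
halves-unsplit []       S       = refl
halves-unsplit (h ∷ hs) []      = cong₂ _∷_ (half-twicePlus h z≤n) (halves-unsplit hs [])
halves-unsplit (h ∷ hs) (a ∷ S) with a ≟ suc (length hs)
... | yes _ = cong₂ _∷_ (half-twicePlus h (s≤s z≤n)) (halves-unsplit hs S)
... | no  _ = cong₂ _∷_ (half-twicePlus h z≤n) (halves-unsplit hs (a ∷ S))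

oddPositions-unsplit : ∀ hs {S} → StrictDec S → All (1 ≤_) S → All (_≤ length hs) S →
                       oddPositions (unsplit hs S) ≡ S
oddPositions-unsplit []       {[]}    _ _           _           = refl
oddPositions-unsplit []       {a ∷ S} _ (1≤a ∷ _)   (a≤0 ∷ _)   = ⊥-elim (<⇒≱ 1≤a a≤0)
oddPositions-unsplit (h ∷ hs) {[]}    _ _           _           =
  trans (consIfOdd-twicePlus h 0 _ _) (oddPositions-unsplit hs [] [] [])
oddPositions-unsplit (h ∷ hs) {a ∷ S} d (1≤a ∷ 1≤S) (a≤ ∷ S≤) with a ≟ suc (length hs)
... | yes refl =
  trans (consIfOdd-twicePlus h 1 _ _)
        (cong₂ _∷_ (cong suc (length-unsplit hs S))
                   (oddPositions-unsplit hs (strictDec-tail d) 1≤S (All.map ≤-pred (strictDec⇒all d))))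
... | no a≢ =
  trans (consIfOdd-twicePlus h 0 _ _)
        (oddPositions-unsplit hs d (1≤a ∷ 1≤S)
                              (a≤hs ∷ All.map (λ b<a → ≤-trans (<⇒≤ b<a) a≤hs) (strictDec⇒all d)))
  where
  a≤hs = ≤-pred (≤∧≢⇒< a≤ a≢)

unsplit-consIfOdd : ∀ m h hs {S} → All (_≤ length hs) S →
                    unsplit (h ∷ hs) (consIfOdd m (suc (length hs)) S) ≡ twicePlus h (mod2 m) ∷ unsplit hs S
unsplit-consIfOdd zero h hs {[]}    _ = refl
unsplit-consIfOdd zero h hs {a ∷ S} (a≤ ∷ _) with a ≟ suc (length hs)
... | yes refl = ⊥-elim (1+n≰n a≤)
... | no  _    = refl
unsplit-consIfOdd (suc zero) h hs _ with suc (length hs) ≟ suc (length hs)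
... | yes _ = refl
... | no  neq = ⊥-elim (neq refl)
unsplit-consIfOdd (suc (suc m)) h hs S≤ = unsplit-consIfOdd m h hs S≤

unsplit-halves : ∀ M → unsplit (halves M) (oddPositions M) ≡ M
unsplit-halves []      = refl
unsplit-halves (m ∷ M) = begin
  unsplit (⌊ m /2⌋ ∷ halves M) (consIfOdd m (suc (length M)) (oddPositions M))
    ≡⟨ cong (λ n → unsplit (⌊ m /2⌋ ∷ halves M) (consIfOdd m (suc n) (oddPositions M)))
            (sym (List.length-map ⌊_/2⌋ M)) ⟩
  unsplit (⌊ m /2⌋ ∷ halves M) (consIfOdd m (suc (length (halves M))) (oddPositions M))
    ≡⟨ unsplit-consIfOdd m ⌊ m /2⌋ (halves M) O≤ ⟩
  twicePlus ⌊ m /2⌋ (mod2 m) ∷ unsplit (halves M) (oddPositions M)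
    ≡⟨ cong₂ _∷_ (twicePlus-half-mod2 m) (unsplit-halves M) ⟩
  m ∷ M ∎
  where
  open ≡-Reasoning
  O≤ = subst (λ n → All (_≤ n) (oddPositions M)) (sym (List.length-map ⌊_/2⌋ M)) (oddPositions-≤ M)

-- Codes and two-colour partitions

double : ℕ → ℕ
double n = n + n

doubles-even : ∀ l → All Even (map double l)
doubles-even []      = []
doubles-even (a ∷ l) = even a ∷ doubles-even l

halves-doubles : ∀ l → halves (map double l) ≡ l
halves-doubles []      = refl
halves-doubles (a ∷ l) = cong₂ _∷_ (sym (n≡⌊n+n/2⌋ a)) (halves-doubles l)

doubles-halves : ∀ {l} → All Even l → map double (halves l) ≡ l
doubles-halves []             = refl
doubles-halves (even d ∷ evs) = cong₂ _∷_ (cong double (sym (n≡⌊n+n/2⌋ d))) (doubles-halves evs)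

doubles-ascending : ∀ {b l} → Ascending b l → Ascending (double b) (map double l)
doubles-ascending []          = []
doubles-ascending (b<a ∷ a<l) = +-mono-< b<a b<a ∷ doubles-ascending a<l

halves-ascending : ∀ {b l} → Ascending (double b) l → All Even l → Ascending b (halves l)
halves-ascending []                []             = []
halves-ascending {b} (2b<2d ∷ asc) (even d ∷ evs) rewrite sym (n≡⌊n+n/2⌋ d) =
  ≰⇒> (λ d≤b → <⇒≱ 2b<2d (+-mono-≤ d≤b d≤b)) ∷ halves-ascending asc evs

sum-doubles : ∀ l → sum (map double l) ≡ double (sum l)
sum-doubles []      = refl
sum-doubles (a ∷ l) = trans (cong (double a +_) (sum-doubles l)) (regroup a (sum l))
  where
  regroup : ∀ a s → a + a + (s + s) ≡ (a + s) + (a + s)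
  regroup = solve-∀

redParts : Code → List ℕ
redParts (E , M) = climb (length M) E ʳ++ oddPositions M

greenParts : List ℕ → List ℕ
greenParts M = reverse (map double (climb 0 (halves M)))

toPartition : Code → List ℕ × List ℕ
toPartition (E , M) = redParts (E , M) , greenParts M

fromPartition : ℕ → List ℕ × List ℕ → Code
fromPartition ℓ (R , G) =
  gaps ℓ (reverse (takeWhile (ℓ <?_) R)) ,
  unsplit (gaps 0 (halves (reverse G))) (dropWhile (ℓ <?_) R)

redParts-strictDec : ∀ E M → StrictDec (redParts (E , M))
redParts-strictDec E M =
  ʳ++-strictDec (climb-ascending (length M) E) (oddPositions-strictDec M) (oddPositions-≤ M)

redParts-positive : ∀ E M → All (1 ≤_) (redParts (E , M))
redParts-positive E M =
  All-ʳ++ (All.map (≤-trans (s≤s z≤n)) (ascending⇒all (climb-ascending (length M) E))) (oddPositions-positive M)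

length-redParts : ∀ E M → length (redParts (E , M)) ≡ length E + oddCount M
length-redParts E M =
  trans (List.length-ʳ++ (climb (length M) E)) (cong₂ _+_ (length-climb _ E) (length-oddPositions M))

countGreater-redParts : ∀ E M → countGreater (length M) (redParts (E , M)) ≡ length E
countGreater-redParts E M = begin
  length (filter (ℓ <?_) (C ʳ++ oddPositions M))       ≡⟨ cong (length ∘ filter (ℓ <?_)) (List.ʳ++-defn C) ⟩
  length (filter (ℓ <?_) (reverse C ++ oddPositions M)) ≡⟨ length-filter-++ (ℓ <?_) (All-ʳ++ (ascending⇒all (climb-ascending ℓ E)) [])
                                                                             (All.map ≤⇒≯ (oddPositions-≤ M)) ⟩
  length (reverse C)                                    ≡⟨ List.length-reverse C ⟩
  length C                                              ≡⟨ length-climb ℓ E ⟩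
  length E                                              ∎
  where
  open ≡-Reasoning
  ℓ = length M
  C = climb ℓ E

greenParts-ascending : ∀ M → Ascending 0 (map double (climb 0 (halves M)))
greenParts-ascending M = doubles-ascending (climb-ascending 0 (halves M))

greenParts-strictDec : ∀ M → StrictDec (greenParts M)
greenParts-strictDec M = ʳ++-strictDec (greenParts-ascending M) [] []

greenParts-positive : ∀ M → All (1 ≤_) (greenParts M)
greenParts-positive M = All-ʳ++ (ascending⇒all (greenParts-ascending M)) []

greenParts-even : ∀ M → All Even (greenParts M)
greenParts-even M = All-ʳ++ (doubles-even (climb 0 (halves M))) []

length-greenParts : ∀ M → length (greenParts M) ≡ length M
length-greenParts M = begin
  length (greenParts M)                         ≡⟨ List.length-reverse (map double (climb 0 (halves M))) ⟩
  length (map double (climb 0 (halves M)))      ≡⟨ List.length-map double (climb 0 (halves M)) ⟩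
  length (climb 0 (halves M))                   ≡⟨ length-climb 0 (halves M) ⟩
  length (halves M)                             ≡⟨ List.length-map ⌊_/2⌋ M ⟩
  length M                                      ∎
  where open ≡-Reasoning

sum-parts : ∀ E M → sum (redParts (E , M)) + sum (greenParts M) ≡ codeWeight (E , M)
sum-parts E M = begin
  sum (redParts (E , M)) + sum (greenParts M)
    ≡⟨ cong₂ _+_ (sum-ʳ++ (climb ℓ E) (oddPositions M))
                 (trans (sum-ʳ++ (map double (climb 0 H)) []) (trans (+-identityʳ _) (sum-doubles (climb 0 H)))) ⟩
  sum (climb ℓ E) + O + double (sum (climb 0 H))
    ≡⟨ cong₂ (λ a b → a + O + double b) (sum-climb ℓ E)
             (trans (sum-climb 0 H) (cong (λ n → n * 0 + triangle n + weightedSum H) (List.length-map ⌊_/2⌋ M))) ⟩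
  k * ℓ + triangle k + weightedSum E + O + double (ℓ * 0 + triangle ℓ + weightedSum H)
    ≡⟨ regroup k ℓ (triangle k) (triangle ℓ) (weightedSum E) (weightedSum H) O ⟩
  triangle k + k * ℓ + (triangle ℓ + triangle ℓ) + weightedSum E + (weightedSum H + weightedSum H + O)
    ≡⟨ cong (triangle k + k * ℓ + (triangle ℓ + triangle ℓ) + weightedSum E +_) (sym (weightedSum-halves M)) ⟩
  codeWeight (E , M) ∎
  where
  open ≡-Reasoning
  k = length E
  ℓ = length M
  H = halves M
  O = sum (oddPositions M)
  regroup : ∀ k ℓ tk tℓ wE wH O →
            k * ℓ + tk + wE + O + ((ℓ * 0 + tℓ + wH) + (ℓ * 0 + tℓ + wH))
            ≡ tk + k * ℓ + (tℓ + tℓ) + wE + (wH + wH + O)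
  regroup = solve-∀

fromPartition-toPartition : ∀ E M → fromPartition (length M) (toPartition (E , M)) ≡ (E , M)
fromPartition-toPartition E M = cong₂ _,_ E-roundtrip M-roundtrip
  where
  ℓ = length M
  C = climb ℓ E
  O = oddPositions M
  ℓ<C : All (ℓ <_) (reverse C)
  ℓ<C = All-ʳ++ (ascending⇒all (climb-ascending ℓ E)) []
  O≤ℓ : All (∁ (ℓ <_)) O
  O≤ℓ = All.map ≤⇒≯ (oddPositions-≤ M)
  E-roundtrip : gaps ℓ (reverse (takeWhile (ℓ <?_) (C ʳ++ O))) ≡ E
  E-roundtrip = begin
    gaps ℓ (reverse (takeWhile (ℓ <?_) (C ʳ++ O)))        ≡⟨ cong (gaps ℓ ∘ reverse ∘ takeWhile (ℓ <?_)) (List.ʳ++-defn C) ⟩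
    gaps ℓ (reverse (takeWhile (ℓ <?_) (reverse C ++ O))) ≡⟨ cong (gaps ℓ ∘ reverse) (takeWhile-++ (ℓ <?_) ℓ<C O≤ℓ) ⟩
    gaps ℓ (reverse (reverse C))                          ≡⟨ cong (gaps ℓ) (List.reverse-involutive C) ⟩
    gaps ℓ C                                              ≡⟨ gaps-climb ℓ E ⟩
    E                                                     ∎
    where open ≡-Reasoning
  M-roundtrip : unsplit (gaps 0 (halves (reverse (greenParts M)))) (dropWhile (ℓ <?_) (C ʳ++ O)) ≡ M
  M-roundtrip = begin
    unsplit (gaps 0 (halves (reverse (greenParts M)))) (dropWhile (ℓ <?_) (C ʳ++ O))
      ≡⟨ cong₂ unsplit (cong (gaps 0 ∘ halves) (List.reverse-involutive (map double (climb 0 (halves M)))))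
                       (trans (cong (dropWhile (ℓ <?_)) (List.ʳ++-defn C)) (dropWhile-++ (ℓ <?_) ℓ<C O≤ℓ)) ⟩
    unsplit (gaps 0 (halves (map double (climb 0 (halves M))))) O
      ≡⟨ cong (λ hs → unsplit (gaps 0 hs) O) (halves-doubles (climb 0 (halves M))) ⟩
    unsplit (gaps 0 (climb 0 (halves M))) O
      ≡⟨ cong (λ hs → unsplit hs O) (gaps-climb 0 (halves M)) ⟩
    unsplit (halves M) O
      ≡⟨ unsplit-halves M ⟩
    M ∎
    where open ≡-Reasoning

module _ {ℓ R G} (R-dec : StrictDec R) (R-pos : All (1 ≤_) R)
                 (G-dec : StrictDec G) (G-pos : All (1 ≤_) G) (G-even : All Even G) (G-len : length G ≡ ℓ) where

  private
    T = takeWhile (ℓ <?_) R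
    D = dropWhile (ℓ <?_) R
    hs = gaps 0 (halves (reverse G))
    M = unsplit hs D

    reverse-G-ascending : Ascending 0 (reverse G)
    reverse-G-ascending = reverse-ascending G-dec G-pos

    reverse-G-even : All Even (reverse G)
    reverse-G-even = All-ʳ++ G-even []

    length-hs : length hs ≡ ℓ
    length-hs = begin
      length hs                   ≡⟨ length-gaps 0 (halves (reverse G)) ⟩
      length (halves (reverse G)) ≡⟨ List.length-map ⌊_/2⌋ (reverse G) ⟩
      length (reverse G)          ≡⟨ List.length-reverse G ⟩
      length G                    ≡⟨ G-len ⟩
      ℓ                           ∎
      where open ≡-Reasoning

  length-proj₂-fromPartition : length M ≡ ℓ
  length-proj₂-fromPartition = trans (length-unsplit hs D) length-hs

  toPartition-fromPartition : toPartition (fromPartition ℓ (R , G)) ≡ (R , G)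
  toPartition-fromPartition = cong₂ _,_ red-roundtrip green-roundtrip
    where
    open ≡-Reasoning
    oddPositions-M : oddPositions M ≡ D
    oddPositions-M =
      oddPositions-unsplit hs (dropWhile-strictDec (ℓ <?_) R-dec) (dropWhile⁺ (ℓ <?_) R-pos)
        (subst (λ n → All (_≤ n) D) (sym length-hs) (dropWhile-≤ (ℓ <?_) R-dec))
    red-roundtrip : redParts (gaps ℓ (reverse T) , M) ≡ R
    red-roundtrip = begin
      climb (length M) (gaps ℓ (reverse T)) ʳ++ oddPositions M
        ≡⟨ cong₂ (λ n O → climb n (gaps ℓ (reverse T)) ʳ++ O) length-proj₂-fromPartition oddPositions-M ⟩
      climb ℓ (gaps ℓ (reverse T)) ʳ++ D
        ≡⟨ cong (_ʳ++ D) (climb-gaps (reverse-ascending (takeWhile-strictDec (ℓ <?_) R-dec) (all-takeWhile (ℓ <?_) R))) ⟩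
      reverse T ʳ++ D          ≡⟨ List.ʳ++-defn (reverse T) ⟩
      reverse (reverse T) ++ D ≡⟨ cong (_++ D) (List.reverse-involutive T) ⟩
      T ++ D                   ≡⟨ List.takeWhile++dropWhile (ℓ <?_) R ⟩
      R                        ∎
    green-roundtrip : greenParts M ≡ G
    green-roundtrip = begin
      reverse (map double (climb 0 (halves M)))       ≡⟨ cong (reverse ∘ map double ∘ climb 0) (halves-unsplit hs D) ⟩
      reverse (map double (climb 0 hs))               ≡⟨ cong (reverse ∘ map double)
                                                            (climb-gaps (halves-ascending reverse-G-ascending reverse-G-even)) ⟩
      reverse (map double (halves (reverse G)))       ≡⟨ cong reverse (doubles-halves reverse-G-even) ⟩
      reverse (reverse G)                             ≡⟨ List.reverse-involutive G ⟩
      G                                               ∎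

StrictDec-irrelevant : ∀ {l} → Irrelevant (StrictDec l)
StrictDec-irrelevant []        []        = refl
StrictDec-irrelevant [ _ ]     [ _ ]     = refl
StrictDec-irrelevant (p ∷ ps) (q ∷ qs) = cong₂ _∷_ (<-irrelevant p q) (StrictDec-irrelevant ps qs)

Even-irrelevant : ∀ {n} → Irrelevant (Even n)
Even-irrelevant p q = go p q refl
  where
  go : ∀ {m n} (p : Even m) (q : Even n) (e : m ≡ n) → subst Even e p ≡ q
  go (even a) (even b) e
    with refl ← trans (n≡⌊n+n/2⌋ a) (trans (cong ⌊_/2⌋ e) (sym (n≡⌊n+n/2⌋ b)))
    with refl ← uip e refl = refl

IsPartition : ℕ → ℕ → ℕ → ℕ → List ℕ × List ℕ → Set
IsPartition n k ℓ j (R , G) =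
  StrictDec R × All (1 ≤_) R × length R ≡ k + j
  × StrictDec G × All (1 ≤_) G × All Even G × length G ≡ ℓ
  × sum R + sum G ≡ n × countGreater ℓ R ≡ k

IsPartition-irrelevant : ∀ {n k ℓ j p} → Irrelevant (IsPartition n k ℓ j p)
IsPartition-irrelevant =
  ×-irrelevant StrictDec-irrelevant (×-irrelevant (All.irrelevant ≤-irrelevant) (×-irrelevant uip
  (×-irrelevant StrictDec-irrelevant (×-irrelevant (All.irrelevant ≤-irrelevant)
  (×-irrelevant (All.irrelevant Even-irrelevant) (×-irrelevant uip (×-irrelevant uip uip)))))))

codes↔partitions : ∀ n k ℓ j → Σ Code (IsCode n k ℓ j) ↔ Σ (List ℕ × List ℕ) (IsPartition n k ℓ j)
codes↔partitions n k ℓ j =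
  restrict-↔ (λ {c} → IsCode-irrelevant {c = c}) (λ {p} → IsPartition-irrelevant {p = p})
             toPartition (fromPartition ℓ) (λ {c} → to-partition c) (λ {p} → from-partition p)
             (λ {c} (_ , Mℓ , _) → from-to c Mℓ) (λ {p} → to-from p)
  where
  to-partition : ∀ c → IsCode n k ℓ j c → IsPartition n k ℓ j (toPartition c)
  to-partition (E , M) (Ek , Mℓ , cn , oj) =
    redParts-strictDec E M , redParts-positive E M , trans (length-redParts E M) (cong₂ _+_ Ek oj) ,
    greenParts-strictDec M , greenParts-positive M , greenParts-even M , trans (length-greenParts M) Mℓ ,
    trans (sum-parts E M) cn ,
    subst (λ ℓ → countGreater ℓ (redParts (E , M)) ≡ k) Mℓ (trans (countGreater-redParts E M) Ek)

  from-to : ∀ c → length (proj₂ c) ≡ ℓ → fromPartition ℓ (toPartition c) ≡ c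
  from-to (E , M) refl = fromPartition-toPartition E M

  to-from : ∀ p → IsPartition n k ℓ j p → toPartition (fromPartition ℓ p) ≡ p
  to-from (R , G) (Rd , R+ , _ , Gd , G+ , Ge , Gℓ , _) = toPartition-fromPartition Rd R+ Gd G+ Ge Gℓ

  from-partition : ∀ p → IsPartition n k ℓ j p → IsCode n k ℓ j (fromPartition ℓ p)
  from-partition (R , G) α@(Rd , R+ , Rkj , Gd , G+ , Ge , Gℓ , RGn , Rk) = Ek , Mℓ , cn , oj
    where
    E = proj₁ (fromPartition ℓ (R , G))
    M = proj₂ (fromPartition ℓ (R , G))
    roundtrip : toPartition (E , M) ≡ (R , G)
    roundtrip = to-from (R , G) α
    Mℓ : length M ≡ ℓ
    Mℓ = length-proj₂-fromPartition Rd R+ Gd G+ Ge Gℓ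
    Ek : length E ≡ k
    Ek = trans (sym (countGreater-redParts E M)) (trans (cong₂ countGreater Mℓ (cong proj₁ roundtrip)) Rk)
    cn : codeWeight (E , M) ≡ n
    cn = trans (sym (sum-parts E M)) (trans (cong (λ (R , G) → sum R + sum G) roundtrip) RGn)
    oj : oddCount M ≡ j
    oj = +-cancelˡ-≡ k _ _ (trans (cong (_+ oddCount M) (sym Ek))
           (trans (sym (length-redParts E M)) (trans (cong (length ∘ proj₁) roundtrip) Rkj)))

theorem2p2 : (n k ℓ j : ℕ) → j ≤ ℓ → 𝒲 n k ℓ j ⤖ 𝒜 n k ℓ j
theorem2p2 n k ℓ j _ = ↔⇒⤖ (codes↔partitions n k ℓ j ↔-∘ words↔codes n k ℓ j)
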